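{- Let $\zeta$ be an fPCL formula over $P$ and a De Morgan algebra $K$. Then for every $\gamma\in fC(P,K)$, $\|\sim\zeta\|(\gamma)=\bigvee_{\gamma'\subseteq\gamma}\|\zeta\|(\gamma')$, where $\gamma'$ ranges over nonempty subsets of $\gamma$.
   Context: A De Morgan algebra $(K,\vee,\wedge,0,1,\overline{\cdot})$ is a bounded distributive lattice with bottom $0$, top $1$ and a map $k\mapsto\overline k$ with $\overline{\overline k}=k$ and the De Morgan laws. $P$ is a set of ports; a $K$-fuzzy interaction is $\alpha:P\to K$ with $\alpha(p)\ne0$ for some $p$; $fC(P,K)$ is the set of nonempty (finite) sets of $K$-fuzzy interactions. fPIL formulas: $\varphi::=true\mid p\mid\,!\varphi\mid\varphi\sqcup\varphi$ with $\|true\|(\alpha)=1$, $\|p\|(\alpha)=\alpha(p)$, $\|!\varphi\|(\alpha)=\overline{\|\varphi\|(\alpha)}$, $\|\varphi_1\sqcup\varphi_2\|(\alpha)=\|\varphi_1\|(\alpha)\vee\|\varphi_2\|(\alpha)$. fPCL formulas: $\zeta::=\varphi\mid\neg\zeta\mid\zeta\oplus\zeta\mid\zeta\uplus\zeta$, $\sim\zeta:=\zeta\uplus true$; for $\gamma\in fC(P,K)$: $\|\varphi\|(\gamma)=\bigwedge_{\alpha\in\gamma}\|\varphi\|(\alpha)$, $\|\neg\zeta\|(\gamma)=\overline{\|\zeta\|(\gamma)}$, $\|\zeta_1\oplus\zeta_2\|(\gamma)=\|\zeta_1\|(\gamma)\vee\|\zeta_2\|(\gamma)$, $\|\zeta_1\uplus\zeta_2\|(\gamma)=\bigvee_{\gamma_1,\gamma_2\in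 fC(P,K),\,\gamma_1\cup\gamma_2=\gamma}(\|\zeta_1\|(\gamma_1)\wedge\|\zeta_2\|(\gamma_2))$. -}

module Defs where

open import Level using (Level; _⊔_) renaming (suc to lsuc)
open import Data.Bool using (Bool; true; false; if_then_else_) renaming (_∨_ to _∨ᵇ_; _∧_ to _∧ᵇ_)
open import Data.Nat using (ℕ; zero; suc)
open import Data.List using (List; []; _∷_; [_]; _++_; map; foldr; length; concatMap)
open import Data.Vec using (Vec; []; _∷_)
open import Data.Product using (∃; _,_)
open import Relation.Nullary using (¬_)
open import Relation.Binary using (Rel)
open import Algebra.Core using (Op₁; Op₂)
open import Algebra.Definitions using (Congruent₁)
open import Algebra.Lattice.Structures using (IsDistributiveLattice)

record DeMorganAlgebra (c ℓ : Level) : Set (lsuc (c ⊔ ℓ)) where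
  infix  8 ‾_
  infixr 7 _∧_
  infixr 6 _∨_
  infix  4 _≈_
  field
    Carrier : Set c
    _≈_     : Rel Carrier ℓ
    _∨_     : Op₂ Carrier
    _∧_     : Op₂ Carrier
    ‾_      : Op₁ Carrier
    ⊥       : Carrier
    ⊤       : Carrier
    isDistributiveLattice : IsDistributiveLattice _≈_ _∨_ _∧_
    ∨-identityˡ : ∀ x → (⊥ ∨ x) ≈ x
    ∧-identityˡ : ∀ x → (⊤ ∧ x) ≈ x
    ‾-cong      : Congruent₁ _≈_ ‾_
    ‾-involutive : ∀ x → (‾ (‾ x)) ≈ x
    deMorgan-∨  : ∀ x y → (‾ (x ∨ y)) ≈ (‾ x ∧ ‾ y)
    deMorgan-∧  : ∀ x y → (‾ (x ∧ y)) ≈ (‾ x ∨ ‾ y)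

  open IsDistributiveLattice isDistributiveLattice public

  ⋁ : List Carrier → Carrier
  ⋁ = foldr _∨_ ⊥

  ⋀ : List Carrier → Carrier
  ⋀ = foldr _∧_ ⊤

record Interaction {c ℓ p} (P : Set p) (K : DeMorganAlgebra c ℓ) : Set (p ⊔ c ⊔ ℓ) where
  open DeMorganAlgebra K
  field
    α        : P → Carrier
    nonzero  : ∃ λ q → ¬ (α q ≈ ⊥)

-- An element of fC(P,K) is a nonempty finite set of interactions, presented
-- by a (nonempty) list enumerating its elements.
Config : ∀ {c ℓ p} (P : Set p) (K : DeMorganAlgebra c ℓ) → Set (p ⊔ c ⊔ ℓ)
Config P K = List (Interaction P K)

data PIL {p} (P : Set p) : Set p where
  true : PIL P
  port : P → PIL P
  !_   : PIL P → PIL P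
  _⊔ᶠ_ : PIL P → PIL P → PIL P

data PCL {p} (P : Set p) : Set p where
  pil  : PIL P → PCL P
  ¬ᶠ_  : PCL P → PCL P
  _⊕_  : PCL P → PCL P → PCL P
  _⊎_  : PCL P → PCL P → PCL P

∼_ : ∀ {p} {P : Set p} → PCL P → PCL P
∼ ζ = ζ ⊎ pil true

subsets : (n : ℕ) → List (Vec Bool n)
subsets zero    = [ [] ]
subsets (suc n) = map (true ∷_) (subsets n) ++ map (false ∷_) (subsets n)

select : ∀ {a} {A : Set a} (xs : List A) → Vec Bool (length xs) → List A
select []       []           = []
select (x ∷ xs) (true  ∷ bs) = x ∷ select xs bs
select (x ∷ xs) (false ∷ bs) = select xs bs

nonemptyᵇ : ∀ {n} → Vec Bool n → Bool
nonemptyᵇ []       = false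
nonemptyᵇ (b ∷ bs) = b ∨ᵇ nonemptyᵇ bs

coversᵇ : ∀ {n} → Vec Bool n → Vec Bool n → Bool
coversᵇ []       []       = true
coversᵇ (b ∷ bs) (c ∷ cs) = (b ∨ᵇ c) ∧ᵇ coversᵇ bs cs

nonemptySubsets : (n : ℕ) → List (Vec Bool n)
nonemptySubsets n = concatMap (λ S → if nonemptyᵇ S then [ S ] else []) (subsets n)


module _ {c ℓ p} {P : Set p} (K : DeMorganAlgebra c ℓ) where
  open DeMorganAlgebra K

  ⟦_⟧ᴵ : PIL P → Interaction P K → Carrier
  ⟦ true ⟧ᴵ     a = ⊤
  ⟦ port q ⟧ᴵ   a = Interaction.α a q
  ⟦ ! φ ⟧ᴵ      a = ‾ (⟦ φ ⟧ᴵ a)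
  ⟦ φ ⊔ᶠ ψ ⟧ᴵ   a = ⟦ φ ⟧ᴵ a ∨ ⟦ ψ ⟧ᴵ a

  ⟦_⟧ : PCL P → Config P K → Carrier
  ⟦ pil φ ⟧  γ = ⋀ (map ⟦ φ ⟧ᴵ γ)
  ⟦ ¬ᶠ ζ ⟧   γ = ‾ (⟦ ζ ⟧ γ)
  ⟦ ζ ⊕ η ⟧  γ = ⟦ ζ ⟧ γ ∨ ⟦ η ⟧ γ
  ⟦ ζ ⊎ η ⟧  γ =
    ⋁ (concatMap (λ S₁ → concatMap (λ S₂ →
          if coversᵇ S₁ S₂
            then [ ⟦ ζ ⟧ (select γ S₁) ∧ ⟦ η ⟧ (select γ S₂) ]
            else [])
         (nonemptySubsets (length γ)))
       (nonemptySubsets (length γ)))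

-- The component ζ ⊎ true of a decomposition γ = γ₁ ∪ γ₂ contributes
-- ‖ζ‖(γ₁) ∧ 1 = ‖ζ‖(γ₁), so every term of the join defining ‖∼ζ‖(γ) is a
-- value ‖ζ‖(γ₁) with γ₁ ⊆ γ nonempty; conversely each such value occurs,
-- paired with γ₂ = γ, which covers γ together with any γ₁.
module Submission where

open import Defs
open import Function using (_∘_)
open import Data.Bool using (Bool; true; false; if_then_else_)
open import Data.Nat using (ℕ; zero; suc)
open import Data.List using (List; []; _∷_; [_]; _++_; map; length; concatMap)
open import Data.Vec using (Vec; []; _∷_; replicate)
open import Data.List.Membership.Propositional using (_∈_)
open import Data.List.Membership.Propositional.Properties using (∈-map⁺; ∈-++⁺ˡ; ∈-concatMap⁺)
open import Data.List.Relation.Unary.Any as Any using (here; there)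
open import Relation.Binary.PropositionalEquality using (_≡_) renaming (refl to ≡-refl)
open import Relation.Nullary using (¬_)
open import Data.Empty using (⊥-elim)
open import Algebra.Lattice.Bundles using (Lattice)
open import Algebra.Lattice.Properties.Lattice using (∨-orderTheoreticJoinSemilattice)
import Relation.Binary.Lattice.Bundles as Order
import Relation.Binary.Reasoning.Setoid as SetoidReasoning

module FiniteJoins {c ℓ} (K : DeMorganAlgebra c ℓ) where
  open DeMorganAlgebra K

  lattice : Lattice c ℓ
  lattice = record { isLattice = isLattice }

  open Order.JoinSemilattice (∨-orderTheoreticJoinSemilattice lattice) public
    using (_≤_; antisym; ∨-least; x≤x∨y; y≤x∨y)
    renaming (trans to ≤-trans; reflexive to ≤-reflexive)
  open SetoidReasoning (Lattice.setoid lattice)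

  ⊥-minimum : ∀ x → ⊥ ≤ x
  ⊥-minimum x = sym (trans (∨-comm x ⊥) (∨-identityˡ x))

  x∧⊤≈x : ∀ x → x ∧ ⊤ ≈ x
  x∧⊤≈x x = trans (∧-comm x ⊤) (∧-identityˡ x)

  ⋁-[_] : ∀ x → ⋁ [ x ] ≈ x
  ⋁-[ x ] = trans (∨-comm x ⊥) (∨-identityˡ x)

  ⋁-++ : ∀ xs ys → ⋁ (xs ++ ys) ≈ ⋁ xs ∨ ⋁ ys
  ⋁-++ []       ys = sym (∨-identityˡ (⋁ ys))
  ⋁-++ (x ∷ xs) ys = begin
    x ∨ ⋁ (xs ++ ys)      ≈⟨ ∨-cong refl (⋁-++ xs ys) ⟩
    x ∨ (⋁ xs ∨ ⋁ ys)     ≈⟨ sym (∨-assoc x (⋁ xs) (⋁ ys)) ⟩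
    (x ∨ ⋁ xs) ∨ ⋁ ys     ∎

  ⋁-concatMap : ∀ {a} {A : Set a} (g : A → List Carrier) xs →
                ⋁ (concatMap g xs) ≈ ⋁ (map (⋁ ∘ g) xs)
  ⋁-concatMap g []       = refl
  ⋁-concatMap g (x ∷ xs) = trans (⋁-++ (g x) (concatMap g xs)) (∨-cong refl (⋁-concatMap g xs))

  ⋁-map-cong : ∀ {a} {A : Set a} {g h : A → Carrier} → (∀ x → g x ≈ h x) →
               ∀ xs → ⋁ (map g xs) ≈ ⋁ (map h xs)
  ⋁-map-cong g≈h []       = refl
  ⋁-map-cong g≈h (x ∷ xs) = ∨-cong (g≈h x) (⋁-map-cong g≈h xs)

  ⋁-map-least : ∀ {a} {A : Set a} {g : A → Carrier} {z} → (∀ x → g x ≤ z) →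
                ∀ xs → ⋁ (map g xs) ≤ z
  ⋁-map-least {z = z} g≤z []       = ⊥-minimum z
  ⋁-map-least         g≤z (x ∷ xs) = ∨-least (g≤z x) (⋁-map-least g≤z xs)

  ⋁-map-upper : ∀ {a} {A : Set a} (g : A → Carrier) {x xs} → x ∈ xs → g x ≤ ⋁ (map g xs)
  ⋁-map-upper g                (here ≡-refl) = x≤x∨y _ _
  ⋁-map-upper g {xs = y ∷ _} (there x∈xs)  = ≤-trans (⋁-map-upper g x∈xs) (y≤x∨y (g y) _)

  ⋁-map-attained : ∀ {a} {A : Set a} {g : A → Carrier} {z x xs} →
                   (∀ y → g y ≤ z) → x ∈ xs → z ≤ g x → ⋁ (map g xs) ≈ z
  ⋁-map-attained {g = g} {xs = xs} g≤z x∈xs z≤gx =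
    antisym (⋁-map-least g≤z xs) (≤-trans z≤gx (⋁-map-upper g x∈xs))

full : ∀ n → Vec Bool n
full n = replicate n true

full∈subsets : ∀ n → full n ∈ subsets n
full∈subsets zero    = here ≡-refl
full∈subsets (suc n) = ∈-++⁺ˡ (∈-map⁺ (true ∷_) (full∈subsets n))

full∈nonemptySubsets : ∀ n → full (suc n) ∈ nonemptySubsets (suc n)
full∈nonemptySubsets n =
  ∈-concatMap⁺ (λ S → if nonemptyᵇ S then [ S ] else [])
    (Any.map (λ { ≡-refl → here ≡-refl }) (full∈subsets (suc n)))

coversᵇ-full : ∀ {n} (S : Vec Bool n) → coversᵇ S (full n) ≡ true
coversᵇ-full []          = ≡-refl
coversᵇ-full (false ∷ S) = coversᵇ-full S
coversᵇ-full (true ∷ S)  = coversᵇ-full S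

module _ {c ℓ p} (K : DeMorganAlgebra c ℓ) {P : Set p} where
  open DeMorganAlgebra K
  open FiniteJoins K

  ⟦true⟧≈⊤ : (γ : Config P K) → ⟦ K ⟧ (pil true) γ ≈ ⊤
  ⟦true⟧≈⊤ []      = refl
  ⟦true⟧≈⊤ (_ ∷ γ) = trans (∧-identityˡ _) (⟦true⟧≈⊤ γ)

  ⟦⊎-valid⟧ : (ζ η : PCL P) → (∀ γ → ⟦ K ⟧ η γ ≈ ⊤) → (a : Interaction P K) (as : Config P K) →
             let γ = a ∷ as in
             ⟦ K ⟧ (ζ ⊎ η) γ ≈ ⋁ (map (λ S → ⟦ K ⟧ ζ (select γ S)) (nonemptySubsets (length γ)))
  ⟦⊎-valid⟧ ζ η η-valid a as = begin
    ⋁ (concatMap (λ S₁ → concatMap (part S₁) NE) NE)   ≈⟨ ⋁-concatMap (λ S₁ → concatMap (part S₁) NE) NE ⟩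
    ⋁ (map (λ S₁ → ⋁ (concatMap (part S₁) NE)) NE)     ≈⟨ ⋁-map-cong ⋁-parts≈value NE ⟩
    ⋁ (map value NE)                                   ∎
    where
    open SetoidReasoning (Lattice.setoid lattice)
    γ  = a ∷ as
    n  = length γ
    NE = nonemptySubsets n

    value : Vec Bool n → Carrier
    value S = ⟦ K ⟧ ζ (select γ S)

    part : Vec Bool n → Vec Bool n → List Carrier
    part S₁ S₂ = if coversᵇ S₁ S₂ then [ value S₁ ∧ ⟦ K ⟧ η (select γ S₂) ] else []

    term≈value : ∀ S₁ S₂ → ⋁ [ value S₁ ∧ ⟦ K ⟧ η (select γ S₂) ] ≈ value S₁
    term≈value S₁ S₂ = trans ⋁-[ _ ] (trans (∧-cong refl (η-valid _)) (x∧⊤≈x (value S₁)))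

    part≤value : ∀ S₁ S₂ → ⋁ (part S₁ S₂) ≤ value S₁
    part≤value S₁ S₂ with coversᵇ S₁ S₂
    ... | true  = ≤-reflexive (term≈value S₁ S₂)
    ... | false = ⊥-minimum (value S₁)

    value≤part-full : ∀ S₁ → value S₁ ≤ ⋁ (part S₁ (full n))
    value≤part-full S₁ rewrite coversᵇ-full S₁ = ≤-reflexive (sym (term≈value S₁ (full n)))

    ⋁-parts≈value : ∀ S₁ → ⋁ (concatMap (part S₁) NE) ≈ value S₁
    ⋁-parts≈value S₁ = trans (⋁-concatMap (part S₁) NE)
      (⋁-map-attained (part≤value S₁) (full∈nonemptySubsets (length as)) (value≤part-full S₁))

mainTheorem6 : ∀ {c ℓ p} (K : DeMorganAlgebra c ℓ) (P : Set p) (ζ : PCL P)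
                 (γ : Config P K) → ¬ (γ ≡ []) →
                 DeMorganAlgebra._≈_ K (⟦ K ⟧ (∼ ζ) γ)
                   (DeMorganAlgebra.⋁ K (map (λ S → ⟦ K ⟧ ζ (select γ S)) (nonemptySubsets (length γ))))
mainTheorem6 K P ζ []       γ≢[] = ⊥-elim (γ≢[] ≡-refl)
mainTheorem6 K P ζ (a ∷ as) _    = ⟦⊎-valid⟧ K ζ (pil true) (⟦true⟧≈⊤ K) a as
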